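{- $|\mathbf{B}^{10}| \ge 129687123005$.
   Context: For positive integers $j,k$, a positive integer $n$ is called $(j,k)$-representable if $n = x_1^k + \cdots + x_j^k$ with all $x_i$ positive integers. Let $\mathbf{B}_j^k$ denote the set of positive integers that are not $(j,k)$-representable, and put $S_j^k = \{ n - j : n \in \mathbf{B}_j^k,\ n > j\}$. Define $\mathbf{B}^k = \bigcap_{j \ge 1} S_j^k$ (the eventual common value of the non-increasing chain $S_j^k$). -}

module Defs where

open import Data.Nat using (ℕ; _+_; _^_; _≤_; _<_; _>_)
open import Data.Vec using (Vec; map; sum)
open import Data.Vec.Relation.Unary.All using (All)
open import Data.Fin using (Fin)
open import Data.Product using (Σ; _×_)
open import Relation.Nullary using (¬_)
open import Relation.Binary.PropositionalEquality using (_≡_)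
open import Function.Definitions using (Injective)

Representable : (j k n : ℕ) → Set
Representable j k n =
  Σ (Vec ℕ j) λ xs → All (λ x → 0 < x) xs × sum (map (λ x → x ^ k) xs) ≡ n

InB : (j k n : ℕ) → Set
InB j k n = 0 < n × ¬ Representable j k n

InS : (j k m : ℕ) → Set
InS j k m = Σ ℕ λ n → InB j k n × n > j × m + j ≡ n

InBk : (k m : ℕ) → Set
InBk k m = (j : ℕ) → 1 ≤ j → InS j k m

CardAtLeast : (ℕ → Set) → ℕ → Set
CardAtLeast A N = Σ (Fin N → ℕ) λ f → Injective _≡_ _≡_ f × ((i : Fin N) → A (f i))

-- A tenth power is ≡ 1 (mod 11) unless its base is divisible by 11, in which case it is
-- ≡ 0 (mod 11) and at least 11¹⁰. So if n = x₁¹⁰ + ⋯ + x_j¹⁰ with c of the xᵢ divisible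
-- by 11, the excess m = n − j satisfies m ≡ −c (mod 11) and m ≥ c (11¹⁰ − 1); and if c = 0,
-- either m = 0 or m ≥ 2¹⁰ − 1 = 1023. Hence, independently of j, every m ≡ s ≢ 0 (mod 11)
-- with m < (11 − s)(11¹⁰ − 1) lies in 𝐁¹⁰, and so do 11, 22, …, 110. Counting these gives
-- 10 + Σ_{s=1}^{10} ((11 − s) 11⁹ − 1) = 5 · 11¹⁰ = 129687123005 elements.
module Submission where

open import Defs
open import Data.Nat
open import Data.Nat.Properties
open import Data.Nat.DivMod
open import Data.Nat.Divisibility using (_∣_; divides; ∣m+n∣m⇒∣n; ∣⇒≤; n∣m*n; m%n≡0⇒n∣m)
open import Data.Nat.Tactic.RingSolver using (solve-∀)
open import Algebra.Properties.CommutativeSemigroup +-commutativeSemigroup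
  using () renaming (interchange to +-interchange)
open import Data.Vec using (Vec; []; _∷_; map; sum)
open import Data.Vec.Relation.Unary.All using (All; []; _∷_)
open import Data.Fin using (Fin; toℕ; splitAt; join)
open import Data.Fin.Properties using (toℕ<n; toℕ-injective; join-splitAt)
open import Data.Product using (∃-syntax; _×_; _,_)
open import Data.Sum using (_⊎_; inj₁; inj₂; [_,_]′)
open import Data.Empty using (⊥)
open import Function using (_∘_)
open import Function.Definitions using (Injective)
open import Relation.Nullary using (¬_; yes; no)
open import Relation.Nullary.Decidable using (toWitness; _→-dec_)
open import Relation.Binary.PropositionalEquality

module _ {A B : ℕ → Set} where

  CardAtLeast-mono : ∀ {n} → (∀ m → A m → B m) → CardAtLeast A n → CardAtLeast B n
  CardAtLeast-mono A⊆B (f , f-inj , f∈A) = f , f-inj , λ i → A⊆B (f i) (f∈A i)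

  CardAtLeast-⊎ : ∀ {a b} → (∀ m → A m → B m → ⊥) →
                  CardAtLeast A a → CardAtLeast B b → CardAtLeast (λ m → A m ⊎ B m) (a + b)
  CardAtLeast-⊎ {a} {b} disjoint (f , f-inj , f∈A) (g , g-inj , g∈B) = h , h-inj , h∈A⊎B
    where
    h′ : Fin a ⊎ Fin b → ℕ
    h′ = [ f , g ]′

    h : Fin (a + b) → ℕ
    h = h′ ∘ splitAt a

    h′-inj : Injective _≡_ _≡_ h′
    h′-inj {inj₁ i} {inj₁ i′} eq = cong inj₁ (f-inj eq)
    h′-inj {inj₁ i} {inj₂ i′} eq with () ← disjoint (f i) (f∈A i) (subst B (sym eq) (g∈B i′))
    h′-inj {inj₂ i} {inj₁ i′} eq with () ← disjoint (f i′) (f∈A i′) (subst B eq (g∈B i))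
    h′-inj {inj₂ i} {inj₂ i′} eq = cong inj₂ (g-inj eq)

    h-inj : Injective _≡_ _≡_ h
    h-inj {i} {i′} eq = begin
      i                        ≡⟨ join-splitAt a b i ⟨
      join a b (splitAt a i)   ≡⟨ cong (join a b) (h′-inj {splitAt a i} {splitAt a i′} eq) ⟩
      join a b (splitAt a i′)  ≡⟨ join-splitAt a b i′ ⟩
      i′                       ∎
      where open ≡-Reasoning

    h′∈A⊎B : ∀ u → A (h′ u) ⊎ B (h′ u)
    h′∈A⊎B (inj₁ i) = inj₁ (f∈A i)
    h′∈A⊎B (inj₂ i) = inj₂ (g∈B i)

    h∈A⊎B : ∀ i → A (h i) ⊎ B (h i)
    h∈A⊎B = h′∈A⊎B ∘ splitAt a

CardAtLeast-injection : ∀ {A : ℕ → Set} {n} (g : ℕ → ℕ) → Injective _≡_ _≡_ g →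
                        (∀ {q} → q < n → A (g q)) → CardAtLeast A n
CardAtLeast-injection g g-inj g∈A =
  g ∘ toℕ , toℕ-injective ∘ g-inj , λ i → g∈A (toℕ<n i)

sumBelow : ℕ → (ℕ → ℕ) → ℕ
sumBelow zero    N = 0
sumBelow (suc k) N = sumBelow k N + N k

CardAtLeast-byClass : ∀ {A : ℕ → Set} (f N : ℕ → ℕ) k →
                      (∀ {r} → r < k → CardAtLeast (λ m → A m × f m ≡ r) (N r)) →
                      CardAtLeast (λ m → A m × f m < k) (sumBelow k N)
CardAtLeast-byClass f N zero    _     = (λ ()) , (λ { {()} }) , (λ ())
CardAtLeast-byClass {A} f N (suc k) card-class =
  CardAtLeast-mono merge
    (CardAtLeast-⊎ disjoint (CardAtLeast-byClass {A} f N k (card-class ∘ m≤n⇒m≤1+n)) (card-class ≤-refl))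
  where
  disjoint : ∀ m → A m × f m < k → A m × f m ≡ k → ⊥
  disjoint _ (_ , lt) (_ , refl) = <-irrefl refl lt

  merge : ∀ m → (A m × f m < k) ⊎ (A m × f m ≡ k) → A m × f m < suc k
  merge _ (inj₁ (a , lt))   = a , m≤n⇒m≤1+n lt
  merge _ (inj₂ (a , refl)) = a , ≤-refl

%-distribˡ-^ : ∀ m n d .{{_ : NonZero d}} → (m ^ n) % d ≡ ((m % d) ^ n) % d
%-distribˡ-^ m zero    d = refl
%-distribˡ-^ m (suc n) d = begin
  (m * m ^ n) % d                        ≡⟨ %-distribˡ-* m (m ^ n) d ⟩
  (m % d * (m ^ n % d)) % d              ≡⟨ cong (λ z → (z * (m ^ n % d)) % d) (m%n%n≡m%n m d) ⟨
  (m % d % d * (m ^ n % d)) % d          ≡⟨ cong (λ z → (m % d % d * z) % d) (%-distribˡ-^ m n d) ⟩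
  (m % d % d * ((m % d) ^ n % d)) % d    ≡⟨ %-distribˡ-* (m % d) ((m % d) ^ n) d ⟨
  (m % d * (m % d) ^ n) % d              ∎
  where open ≡-Reasoning

^-distribʳ-* : ∀ m n k → (m * n) ^ k ≡ m ^ k * n ^ k
^-distribʳ-* m n zero    = refl
^-distribʳ-* m n (suc k) rewrite ^-distribʳ-* m n k = regroup m n (m ^ k) (n ^ k)
  where
  regroup : ∀ a b x y → a * b * (x * y) ≡ a * x * (b * y)
  regroup = solve-∀

fermat-11 : ∀ {r} → r < 11 → 0 < r → r ^ 10 % 11 ≡ 1
fermat-11 = toWitness {a? = allUpTo? (λ r → 0 <? r →-dec r ^ 10 % 11 ≟ 1) 11} _

-- Opaque, since unfolding a term such as 11 ^ 10 + x with x neutral proceeds in unary.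
opaque
  H G : ℕ
  H = 11 ^ 9
  G = 11 ^ 10 ∸ 1

  11¹⁰≡H*11 : 11 ^ 10 ≡ H * 11
  11¹⁰≡H*11 = refl

  suc-G : suc G ≡ H * 11
  suc-G = refl

  G>110 : 110 < G
  G>110 = ≤ᵇ⇒≤ 111 G _

-- In ExcessForm, c counts the bases divisible by 11. If there is none, every base is 1
-- (A = 0) or some base is at least 2, whose tenth power alone gives 11 A ≥ 2¹⁰ − 1 = 11 · 93.
data Admissible (c A : ℕ) : Set where
  some-multiple : 1 ≤ c → Admissible c A
  no-excess     : A ≡ 0 → Admissible c A
  large-excess  : 93 ≤ A → Admissible c A

record ExcessForm (m : ℕ) : Set where
  constructor excessForm
  field
    c A        : ℕ
    excess≡    : m ≡ c * G + 11 * A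
    admissible : Admissible c A

Admissible-+ : ∀ {c₁ c₂ A₁ A₂} → Admissible c₁ A₁ → Admissible c₂ A₂ →
               Admissible (c₁ + c₂) (A₁ + A₂)
Admissible-+ {c₁} {c₂} (some-multiple c₁≥1) _ = some-multiple (≤-trans c₁≥1 (m≤m+n c₁ c₂))
Admissible-+ {c₁} {c₂} _ (some-multiple c₂≥1) = some-multiple (≤-trans c₂≥1 (m≤n+m c₂ c₁))
Admissible-+ (no-excess refl)    (no-excess refl)    = no-excess refl
Admissible-+ (no-excess refl)    (large-excess A₂≥93) = large-excess A₂≥93
Admissible-+ {A₁ = A₁} {A₂} (large-excess A₁≥93) _ = large-excess (≤-trans A₁≥93 (m≤m+n A₁ A₂))

ExcessForm-0 : ExcessForm 0
ExcessForm-0 = excessForm 0 0 refl (no-excess refl)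

ExcessForm-+ : ∀ {m n} → ExcessForm m → ExcessForm n → ExcessForm (m + n)
ExcessForm-+ (excessForm c₁ A₁ refl adm₁) (excessForm c₂ A₂ refl adm₂) =
  excessForm (c₁ + c₂) (A₁ + A₂) (regroup c₁ c₂ A₁ A₂ G) (Admissible-+ adm₁ adm₂)
  where
  regroup : ∀ c₁ c₂ A₁ A₂ g →
            c₁ * g + 11 * A₁ + (c₂ * g + 11 * A₂) ≡ (c₁ + c₂) * g + 11 * (A₁ + A₂)
  regroup = solve-∀

ExcessForm-residue : ∀ {m} (e : ExcessForm m) → 11 ∣ m + ExcessForm.c e
ExcessForm-residue (excessForm c A refl _) = divides (c * H + A) (begin
  c * G + 11 * A + c      ≡⟨ absorb c A G ⟩
  c * suc G + 11 * A      ≡⟨ cong (λ g → c * g + 11 * A) suc-G ⟩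
  c * (H * 11) + 11 * A   ≡⟨ factor c A H ⟩
  (c * H + A) * 11        ∎)
  where
  open ≡-Reasoning
  absorb : ∀ c A g → c * g + 11 * A + c ≡ c * suc g + 11 * A
  absorb = solve-∀
  factor : ∀ c A h → c * (h * 11) + 11 * A ≡ (c * h + A) * 11
  factor = solve-∀

divisible-tenth-power-excess : ∀ {x} → 0 < x → 11 ∣ x → ∃[ m ] x ^ 10 ≡ 1 + m × ExcessForm m
divisible-tenth-power-excess x>0 (divides q refl) =
  G + 11 * A , q¹⁰11¹⁰≡ ,
  excessForm 1 A (cong (_+ 11 * A) (sym (*-identityˡ G))) (some-multiple ≤-refl)
  where
  instance
    q≢0 : NonZero q
    q≢0 = m*n≢0⇒m≢0 q {{>-nonZero x>0}}

  A = pred (q ^ 10) * H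

  expand : ∀ p h → suc p * (h * 11) ≡ h * 11 + 11 * (p * h)
  expand = solve-∀

  q¹⁰11¹⁰≡ : (q * 11) ^ 10 ≡ 1 + (G + 11 * A)
  q¹⁰11¹⁰≡ = begin
    (q * 11) ^ 10                  ≡⟨ ^-distribʳ-* q 11 10 ⟩
    q ^ 10 * 11 ^ 10               ≡⟨ cong (q ^ 10 *_) 11¹⁰≡H*11 ⟩
    q ^ 10 * (H * 11)              ≡⟨ cong (_* (H * 11)) (suc-pred (q ^ 10) {{m^n≢0 q 10}}) ⟨
    suc (pred (q ^ 10)) * (H * 11) ≡⟨ expand (pred (q ^ 10)) H ⟩
    H * 11 + 11 * A                ≡⟨ cong (_+ 11 * A) suc-G ⟨
    1 + (G + 11 * A)               ∎
    where open ≡-Reasoning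

coprime-tenth-power-excess : ∀ {x} → 1 < x → x % 11 ≢ 0 → ∃[ m ] x ^ 10 ≡ 1 + m × ExcessForm m
coprime-tenth-power-excess {x} x>1 x%11≢0 =
  A * 11 , x¹⁰≡ , excessForm 0 A (*-comm A 11) (large-excess A≥93)
  where
  A = x ^ 10 / 11

  x¹⁰≡ : x ^ 10 ≡ 1 + A * 11
  x¹⁰≡ = begin
    x ^ 10                       ≡⟨ m≡m%n+[m/n]*n (x ^ 10) 11 ⟩
    x ^ 10 % 11 + A * 11         ≡⟨ cong (_+ A * 11) (%-distribˡ-^ x 10 11) ⟩
    (x % 11) ^ 10 % 11 + A * 11  ≡⟨ cong (_+ A * 11) (fermat-11 (m%n<n x 11) (n≢0⇒n>0 x%11≢0)) ⟩
    1 + A * 11                   ∎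
    where open ≡-Reasoning

  A≥93 : 93 ≤ A
  A≥93 = *-cancelʳ-≤ 93 A 11 (s≤s⁻¹ (subst (1024 ≤_) x¹⁰≡ (^-monoˡ-≤ 10 x>1)))

tenth-power-excess : ∀ {x} → 0 < x → ∃[ m ] x ^ 10 ≡ 1 + m × ExcessForm m
tenth-power-excess {x} x>0 with m≤n⇒m<n∨m≡n x>0 | x % 11 ≟ 0
... | inj₂ refl | _          = 0 , refl , ExcessForm-0
... | inj₁ x>1  | yes x%11≡0 = divisible-tenth-power-excess x>0 (m%n≡0⇒n∣m x 11 x%11≡0)
... | inj₁ x>1  | no x%11≢0  = coprime-tenth-power-excess x>1 x%11≢0

power-sum-excess : ∀ {j} (xs : Vec ℕ j) → All (0 <_) xs →
                   ∃[ m ] sum (map (_^ 10) xs) ≡ j + m × ExcessForm m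
power-sum-excess []       []           = 0 , refl , ExcessForm-0
power-sum-excess (x ∷ xs) (x>0 ∷ xs>0)
  with m₁ , x¹⁰≡ , e₁ ← tenth-power-excess x>0
     | m₂ , Σ≡ , e₂ ← power-sum-excess xs xs>0 =
  m₁ + m₂ , trans (cong₂ _+_ x¹⁰≡ Σ≡) (+-interchange 1 m₁ _ m₂) , ExcessForm-+ e₁ e₂

Representable⇒ExcessForm : ∀ {j m} → Representable j 10 (j + m) → ExcessForm m
Representable⇒ExcessForm {j} (xs , xs>0 , Σ≡j+m)
  with m′ , Σ≡j+m′ , e ← power-sum-excess xs xs>0 =
  subst ExcessForm (+-cancelˡ-≡ j _ _ (trans (sym Σ≡j+m′) Σ≡j+m)) e

¬ExcessForm⇒InBk : ∀ {m} → 0 < m → ¬ ExcessForm m → InBk 10 m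
¬ExcessForm⇒InBk {m} m>0 ¬e j _ = m + j , (m+j>0 , ¬representable) , +-monoˡ-≤ j m>0 , refl
  where
  m+j>0 : 0 < m + j
  m+j>0 = ≤-trans m>0 (m≤m+n m j)

  ¬representable : ¬ Representable j 10 (m + j)
  ¬representable = ¬e ∘ Representable⇒ExcessForm ∘ subst (Representable j 10) (+-comm m j)

¬ExcessForm-unit-residue : ∀ {s q} → 0 < s → s < 11 → s + q * 11 < (11 ∸ s) * G →
                           ¬ ExcessForm (s + q * 11)
¬ExcessForm-unit-residue {s} {q} s>0 s<11 bound e@(excessForm c A m≡ _) with 11 ∸ s ≤? c
... | yes many = <⇒≱ bound (begin
  (11 ∸ s) * G        ≤⟨ *-monoˡ-≤ G many ⟩
  c * G               ≤⟨ m≤m+n (c * G) (11 * A) ⟩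
  c * G + 11 * A      ≡⟨ m≡ ⟨
  s + q * 11          ∎)
  where open ≤-Reasoning
... | no few = <⇒≱ s+c<11 (∣⇒≤ {{>-nonZero s+c>0}} 11∣s+c)
  where
  s+c>0 : 0 < s + c
  s+c>0 = ≤-trans s>0 (m≤m+n s c)
  s+c<11 : s + c < 11
  s+c<11 = subst (s + c <_) (m+[n∸m]≡n (<⇒≤ s<11)) (+-monoʳ-< s (≰⇒> few))
  11∣s+c : 11 ∣ s + c
  11∣s+c = ∣m+n∣m⇒∣n (subst (11 ∣_) (shuffle s q c) (ExcessForm-residue e)) (n∣m*n q)
    where
    shuffle : ∀ s q c → s + q * 11 + c ≡ q * 11 + (s + c)
    shuffle = solve-∀

¬ExcessForm-small-multiple : ∀ {t} → 0 < t → t ≤ 10 → ¬ ExcessForm (t * 11)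
¬ExcessForm-small-multiple {t} t>0 t≤10 (excessForm (suc c) A t*11≡ _) =
  <⇒≱ (≤-<-trans (*-monoˡ-≤ 11 t≤10) G>110) (begin
    G                          ≤⟨ m≤m+n G (c * G) ⟩
    suc c * G                  ≤⟨ m≤m+n (suc c * G) (11 * A) ⟩
    suc c * G + 11 * A         ≡⟨ t*11≡ ⟨
    t * 11                     ∎)
  where open ≤-Reasoning
¬ExcessForm-small-multiple {t} t>0 t≤10 (excessForm zero A t*11≡ adm)
  with refl ← *-cancelʳ-≡ t A 11 (trans t*11≡ (*-comm 11 A)) with adm
... | no-excess refl    = <-irrefl refl t>0
... | large-excess t≥93 = <⇒≱ (≤-<-trans t≤10 (≤ᵇ⇒≤ 11 93 _)) t≥93

residueClassSize : ℕ → ℕ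
residueClassSize zero    = 10
residueClassSize (suc s) = (10 ∸ s) * H ∸ 1

opaque
  unfolding H G

  unit-residue-class-bound : ∀ {s} → s < 10 →
                             suc s + residueClassSize (suc s) * 11 ≡ (10 ∸ s) * G
  unit-residue-class-bound =
    toWitness {a? = allUpTo? (λ s → suc s + residueClassSize (suc s) * 11 ≟ (10 ∸ s) * G) 10} _

  residueClassSize-total : sumBelow 11 residueClassSize ≡ 129687123005
  residueClassSize-total = refl

residue-class : ∀ {r} → r < 11 → CardAtLeast (λ m → InBk 10 m × m % 11 ≡ r) (residueClassSize r)
residue-class {zero} _ =
  CardAtLeast-injection {A = λ m → InBk 10 m × m % 11 ≡ 0}
    (λ t → suc t * 11) (λ eq → suc-injective (*-cancelʳ-≡ _ _ 11 eq))
    λ {t} t<10 → ¬ExcessForm⇒InBk z<s (¬ExcessForm-small-multiple z<s t<10) , m*n%n≡0 (suc t) 11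
residue-class {suc s} s<11 =
  CardAtLeast-injection {A = λ m → InBk 10 m × m % 11 ≡ suc s}
    (λ q → suc s + q * 11) (λ eq → *-cancelʳ-≡ _ _ 11 (+-cancelˡ-≡ (suc s) _ _ eq))
    λ {q} q<size → ¬ExcessForm⇒InBk z<s (¬ExcessForm-unit-residue {q = q} z<s s<11 (below q<size))
                 , trans ([m+kn]%n≡m%n (suc s) q 11) (m<n⇒m%n≡m s<11)
  where
  below : ∀ {q} → q < residueClassSize (suc s) → suc s + q * 11 < (10 ∸ s) * G
  below {q} q<size = subst (suc s + q * 11 <_) (unit-residue-class-bound (s<s⁻¹ s<11))
                       (+-monoʳ-< (suc s) (*-monoˡ-< 11 q<size))

corollary10p8 : CardAtLeast (InBk 10) 129687123005
corollary10p8 =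
  CardAtLeast-mono {A = Classified} (λ _ (m∈Bk , _) → m∈Bk)
    (subst (CardAtLeast Classified) residueClassSize-total
      (CardAtLeast-byClass {InBk 10} (_% 11) residueClassSize 11 residue-class))
  where
  Classified : ℕ → Set
  Classified m = InBk 10 m × m % 11 < 11
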